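{- If $G$ is a triangle-free, edge-critical graph with $\mathrm{diam}(G)=2$ and minimum degree $\delta(G)\ge 2$, then every edge of $G$ lies in an induced $5$-cycle of $G$.
   Context: All graphs are finite and simple. An edge $xy$ of $G$ is critical if there exist vertices $u,v$ with $\{u,v\}\neq\{x,y\}$ such that $d_{G-xy}(u,v)>d_G(u,v)$; $G$ is edge-critical if all its edges are critical. -}

module Defs where

open import Data.Nat using (ℕ; zero; suc; _≤_; _<_; _≥_)
open import Data.Fin using (Fin; zero; suc)
open import Data.Fin.Properties using () renaming (_≟_ to _≟ᶠ_)
open import Data.List using (List; length; filter)
open import Data.List.Base using (allFin)
open import Data.Product using (Σ; ∃; ∃-syntax; _×_; _,_)
open import Data.Sum using (_⊎_)
open import Data.Empty using (⊥)
open import Relation.Nullary using (¬_; Dec; yes; no; _×-dec_; _⊎-dec_)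
open import Relation.Binary.PropositionalEquality using (_≡_; _≢_)

record Graph (n : ℕ) : Set₁ where
  field
    Adj    : Fin n → Fin n → Set
    adj?   : ∀ u v → Dec (Adj u v)
    sym    : ∀ {u v} → Adj u v → Adj v u
    irrefl : ∀ {u} → ¬ Adj u u
open Graph public

SamePair : ∀ {n} → Fin n → Fin n → Fin n → Fin n → Set
SamePair a b x y = (a ≡ x × b ≡ y) ⊎ (a ≡ y × b ≡ x)

samePair? : ∀ {n} (a b x y : Fin n) → Dec (SamePair a b x y)
samePair? a b x y = ((a ≟ᶠ x) ×-dec (b ≟ᶠ y)) ⊎-dec ((a ≟ᶠ y) ×-dec (b ≟ᶠ x))

deleteEdge : ∀ {n} → Graph n → Fin n → Fin n → Graph n
deleteEdge G x y = record
  { Adj    = λ a b → Adj G a b × ¬ SamePair a b x y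
  ; adj?   = λ a b → dec a b
  ; sym    = λ { (e , ns) → sym G e , λ { (Data.Sum.inj₁ (p , q)) → ns (Data.Sum.inj₂ (q , p))
                                        ; (Data.Sum.inj₂ (p , q)) → ns (Data.Sum.inj₁ (q , p)) } }
  ; irrefl = λ { (e , _) → irrefl G e }
  }
  where
  dec : ∀ a b → Dec (Adj G a b × ¬ SamePair a b x y)
  dec a b with adj? G a b | samePair? a b x y
  ... | yes e | no ns = yes (e , ns)
  ... | no ne | _ = no λ { (e , _) → ne e }
  ... | yes _ | yes s = no λ { (_ , ns) → ns s }

data Walk {n} (G : Graph n) : Fin n → Fin n → ℕ → Set where
  here : ∀ {u} → Walk G u u zero
  step : ∀ {u w v k} → Adj G u w → Walk G w v k → Walk G u v (suc k)

Dist : ∀ {n} → Graph n → Fin n → Fin n → ℕ → Set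
Dist G u v k = Walk G u v k × (∀ m → m < k → ¬ Walk G u v m)

-- d_{G-xy}(u,v) > d_G(u,v)  (including d_{G-xy}(u,v) = ∞)
DistIncreases : ∀ {n} → Graph n → Fin n → Fin n → Fin n → Fin n → Set
DistIncreases G x y u v =
  ∃[ k ] (Dist G u v k × (∀ m → m ≤ k → ¬ Walk (deleteEdge G x y) u v m))

CriticalEdge : ∀ {n} → Graph n → Fin n → Fin n → Set
CriticalEdge G x y = ∃[ u ] ∃[ v ] (¬ SamePair u v x y × DistIncreases G x y u v)

EdgeCritical : ∀ {n} → Graph n → Set
EdgeCritical G = ∀ x y → Adj G x y → CriticalEdge G x y

TriangleFree : ∀ {n} → Graph n → Set
TriangleFree G = ∀ a b c → Adj G a b → Adj G b c → Adj G a c → ⊥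

Diam2 : ∀ {n} → Graph n → Set
Diam2 G = (∀ u v → ∃[ k ] (k ≤ 2 × Dist G u v k)) × (∃[ u ] ∃[ v ] Dist G u v 2)

degree : ∀ {n} → Graph n → Fin n → ℕ
degree G v = length (filter (adj? G v) (allFin _))

MinDegreeAtLeast : ∀ {n} → Graph n → ℕ → Set
MinDegreeAtLeast G d = ∀ v → degree G v ≥ d

next5 : Fin 5 → Fin 5
next5 zero = suc zero
next5 (suc zero) = suc (suc zero)
next5 (suc (suc zero)) = suc (suc (suc zero))
next5 (suc (suc (suc zero))) = suc (suc (suc (suc zero)))
next5 (suc (suc (suc (suc zero)))) = zero

InducedC5 : ∀ {n} → Graph n → (Fin 5 → Fin n) → Set
InducedC5 G f =
  (∀ i j → f i ≡ f j → i ≡ j) ×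
  (∀ i j → (Adj G (f i) (f j) → (j ≡ next5 i ⊎ i ≡ next5 j)) ×
           ((j ≡ next5 i ⊎ i ≡ next5 j) → Adj G (f i) (f j)))

EdgeInInducedC5 : ∀ {n} → Graph n → Fin n → Fin n → Set
EdgeInInducedC5 G x y =
  ∃[ f ] (InducedC5 G f × ∃[ i ] SamePair (f i) (f (next5 i)) x y)

{-# OPTIONS --safe #-}
-- A critical edge xy of a graph of diameter 2 has a witness pair at distance
-- exactly 2 all of whose connecting 2-paths use xy; suitably oriented, this
-- gives a path p – q – r with {p, q} = {x, y} in which q is the only common
-- neighbour of p and r.  As δ ≥ 2, p has a second neighbour a, which cannot be
-- adjacent to r; a path a – b – r then closes p q r b a into a 5-cycle, and
-- triangle-freeness together with the uniqueness of q rules out every chord.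
module Submission where

open import Defs
open import Data.Nat using (ℕ; zero; suc; _≤_; z≤n; s≤s)
open import Data.Nat.Properties using (≤-refl; ≤-trans; m≤m+n)
open import Data.Fin using (Fin; zero; suc)
open import Data.Fin.Properties using (all?) renaming (_≟_ to _≟ᶠ_)
open import Data.List using (List; _∷_; length; filter; allFin)
open import Data.List.Membership.Propositional using (_∈_)
open import Data.List.Membership.Propositional.Properties using (∈-filter⁻)
open import Data.List.Relation.Unary.All using (_∷_)
open import Data.List.Relation.Unary.Any using (here; there)
open import Data.List.Relation.Unary.AllPairs using (_∷_)
open import Data.List.Relation.Unary.Unique.Propositional using (Unique)
open import Data.List.Relation.Unary.Unique.Propositional.Properties
  using (allFin⁺; filter⁺)
open import Data.Product using (∃-syntax; _×_; _,_; proj₂)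
open import Data.Sum using (_⊎_; inj₁; inj₂)
import Data.Sum as Sum
open import Data.Empty using (⊥-elim)
open import Relation.Binary.Definitions using (DecidableEquality)
open import Relation.Nullary using (¬_; yes; no; _⊎-dec_)
open import Relation.Nullary.Decidable using (from-yes)
open import Relation.Binary.PropositionalEquality
  using (_≡_; _≢_; refl; subst) renaming (sym to ≡-sym)

private
  variable
    n : ℕ
    p q r u v w x y : Fin n

unique⇒∃∈≢ : ∀ {A : Set} {xs : List A} → DecidableEquality A →
             Unique xs → 2 ≤ length xs → ∀ c → ∃[ a ] (a ∈ xs × a ≢ c)
unique⇒∃∈≢ {xs = a ∷ b ∷ _} _≟_ ((a≢b ∷ _) ∷ _) (s≤s (s≤s z≤n)) c with a ≟ c
... | no a≢c = a , here refl , a≢c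
... | yes refl = b , there (here refl) , λ b≡a → a≢b (≡-sym b≡a)

neighbour-avoiding : (G : Graph n) → MinDegreeAtLeast G 2 →
                     ∀ v c → ∃[ a ] (Adj G v a × a ≢ c)
neighbour-avoiding {n} G δ≥2 v c
  with unique⇒∃∈≢ _≟ᶠ_ (filter⁺ (adj? G v) {allFin n} (allFin⁺ n)) (δ≥2 v) c
... | a , a∈ , a≢c = a , proj₂ (∈-filter⁻ (adj? G v) {xs = allFin n} a∈) , a≢c

SamePair-swap : SamePair u v x y → SamePair v u x y
SamePair-swap (inj₁ (u≡x , v≡y)) = inj₂ (v≡y , u≡x)
SamePair-swap (inj₂ (u≡y , v≡x)) = inj₁ (v≡x , u≡y)

SamePair-member : SamePair w r x y → SamePair p q x y → w ≡ p ⊎ w ≡ q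
SamePair-member (inj₁ (refl , _)) (inj₁ (refl , _)) = inj₁ refl
SamePair-member (inj₁ (refl , _)) (inj₂ (_ , refl)) = inj₂ refl
SamePair-member (inj₂ (refl , _)) (inj₁ (_ , refl)) = inj₂ refl
SamePair-member (inj₂ (refl , _)) (inj₂ (refl , _)) = inj₁ refl

Diameter≤2 : Graph n → Set
Diameter≤2 G = ∀ u v → ∃[ k ] (k ≤ 2 × Dist G u v k)

within-distance-2 : (G : Graph n) → Diameter≤2 G →
                    ∀ u v → u ≡ v ⊎ Adj G u v ⊎ ∃[ w ] (Adj G u w × Adj G w v)
within-distance-2 G diam u v with diam u v
... | _ , _ , here , _ = inj₁ refl
... | _ , _ , step u-v here , _ = inj₂ (inj₁ u-v)
... | _ , _ , step u-w (step w-v here) , _ = inj₂ (inj₂ (_ , u-w , w-v))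
... | _ , s≤s (s≤s ()) , step _ (step _ (step _ _)) , _

record Bottleneck (G : Graph n) (x y u v : Fin n) : Set where
  field
    ¬u-v       : ¬ Adj G u v
    midpoint   : Fin n
    u-midpoint : Adj G u midpoint
    midpoint-v : Adj G midpoint v
    through-xy : ∀ {w} → Adj G u w → Adj G w v →
                 SamePair u w x y ⊎ SamePair w v x y

Bottleneck-sym : {G : Graph n} → Bottleneck G x y u v → Bottleneck G x y v u
Bottleneck-sym {G = G} B = record
  { ¬u-v       = λ v-u → ¬u-v (sym G v-u)
  ; midpoint   = midpoint
  ; u-midpoint = sym G midpoint-v
  ; midpoint-v = sym G u-midpoint
  ; through-xy = λ v-w w-u →
      Sum.swap (Sum.map SamePair-swap SamePair-swap (through-xy (sym G w-u) (sym G v-w)))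
  }
  where open Bottleneck B

distIncreases⇒bottleneck : (G : Graph n) → Diameter≤2 G →
  ¬ SamePair u v x y → DistIncreases G x y u v → Bottleneck G x y u v
distIncreases⇒bottleneck G diam uv≠xy (_ , (here , _) , lost) =
  ⊥-elim (lost 0 z≤n here)
distIncreases⇒bottleneck G diam uv≠xy (_ , (step u-v here , _) , lost) =
  ⊥-elim (lost 1 ≤-refl (step (u-v , uv≠xy) here))
distIncreases⇒bottleneck {u = u} {v = v} G diam uv≠xy
  (suc (suc (suc k)) , (step _ (step _ (step _ _)) , shortest) , _)
  with diam u v
... | k′ , k′≤2 , walk , _ = ⊥-elim (shortest k′ (s≤s (≤-trans k′≤2 (m≤m+n 2 k))) walk)
distIncreases⇒bottleneck {u = u} {v = v} {x = x} {y = y} G diam uv≠xy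
  (_ , (step u-w (step w-v here) , shortest) , lost) = record
  { ¬u-v       = λ u-v → shortest 1 (s≤s (s≤s z≤n)) (step u-v here)
  ; midpoint   = _
  ; u-midpoint = u-w
  ; midpoint-v = w-v
  ; through-xy = through-xy
  }
  where
  through-xy : ∀ {w} → Adj G u w → Adj G w v → SamePair u w x y ⊎ SamePair w v x y
  through-xy {w} u-w w-v with samePair? u w x y | samePair? w v x y
  ... | yes uw=xy | _ = inj₁ uw=xy
  ... | no _ | yes wv=xy = inj₂ wv=xy
  ... | no uw≠xy | no wv≠xy = ⊥-elim (lost 2 ≤-refl (step (u-w , uw≠xy) (step (w-v , wv≠xy) here)))

record UniqueGeodesic (G : Graph n) (p q r : Fin n) : Set where
  field
    p-q             : Adj G p q
    q-r             : Adj G q r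
    ¬p-r            : ¬ Adj G p r
    unique-midpoint : ∀ {w} → Adj G p w → Adj G w r → w ≡ q

bottleneck⇒uniqueGeodesic : {G : Graph n} → Bottleneck G x y p r →
  SamePair p q x y → Adj G p q → Adj G q r → UniqueGeodesic G p q r
bottleneck⇒uniqueGeodesic {p = p} {q = q} {G = G} B pq=xy p-q q-r = record
  { p-q             = p-q
  ; q-r             = q-r
  ; ¬p-r            = ¬u-v
  ; unique-midpoint = unique-midpoint
  }
  where
  open Bottleneck B
  not-p : ∀ {w} → Adj G p w → w ≡ p ⊎ w ≡ q → w ≡ q
  not-p p-w (inj₁ refl) = ⊥-elim (irrefl G p-w)
  not-p p-w (inj₂ w≡q) = w≡q
  unique-midpoint : ∀ {w} → Adj G p w → Adj G w _ → w ≡ q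
  unique-midpoint p-w w-r with through-xy p-w w-r
  ... | inj₁ pw=xy = not-p p-w (SamePair-member (SamePair-swap pw=xy) pq=xy)
  ... | inj₂ wr=xy = not-p p-w (SamePair-member wr=xy pq=xy)

critical⇒uniqueGeodesic : (G : Graph n) → Diameter≤2 G → CriticalEdge G x y →
  ∃[ p ] ∃[ q ] ∃[ r ] (SamePair p q x y × UniqueGeodesic G p q r)
critical⇒uniqueGeodesic G diam (u , v , uv≠xy , increases)
  with distIncreases⇒bottleneck G diam uv≠xy increases
... | B with Bottleneck.through-xy B (Bottleneck.u-midpoint B) (Bottleneck.midpoint-v B)
...   | inj₁ uw=xy = u , _ , v , uw=xy ,
          bottleneck⇒uniqueGeodesic B uw=xy (Bottleneck.u-midpoint B) (Bottleneck.midpoint-v B)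
...   | inj₂ wv=xy = v , _ , u , SamePair-swap wv=xy ,
          bottleneck⇒uniqueGeodesic (Bottleneck-sym B) (SamePair-swap wv=xy)
            (sym G (Bottleneck.midpoint-v B)) (sym G (Bottleneck.u-midpoint B))

next5-period : ∀ i → next5 (next5 (next5 (next5 (next5 i)))) ≡ i
next5-period zero = refl
next5-period (suc zero) = refl
next5-period (suc (suc zero)) = refl
next5-period (suc (suc (suc zero))) = refl
next5-period (suc (suc (suc (suc zero)))) = refl

cyclic-position : ∀ i j → j ≡ i ⊎ j ≡ next5 i ⊎ i ≡ next5 j ⊎
                          j ≡ next5 (next5 i) ⊎ i ≡ next5 (next5 j)
cyclic-position = from-yes (all? λ i → all? λ j →
  (j ≟ᶠ i) ⊎-dec (j ≟ᶠ next5 i) ⊎-dec (i ≟ᶠ next5 j) ⊎-dec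
  (j ≟ᶠ next5 (next5 i)) ⊎-dec (i ≟ᶠ next5 (next5 j)))

chordless⇒InducedC5 : (G : Graph n) (f : Fin 5 → Fin n) →
  (∀ i → Adj G (f i) (f (next5 i))) →
  (∀ i → ¬ Adj G (f i) (f (next5 (next5 i)))) →
  InducedC5 G f
chordless⇒InducedC5 G f edge chordless =
  injective , λ i j → adjacent⇒consecutive i j , consecutive⇒adjacent i j
  where
  no-edge-collapse : ∀ i → f i ≢ f (next5 i)
  no-edge-collapse i eq = irrefl G (subst (Adj G (f i)) (≡-sym eq) (edge i))

  -- f (i + 3) is adjacent to f (i + 2) but not to f (i + 5) = f i.
  no-chord-collapse : ∀ i → f i ≢ f (next5 (next5 i))
  no-chord-collapse i eq = chordless (next5 j)
    (subst (λ k → Adj G (f (next5 j)) (f k)) (≡-sym (next5-period i))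
      (subst (Adj G (f (next5 j))) (≡-sym eq) (sym G (edge j))))
    where j = next5 (next5 i)

  injective : ∀ i j → f i ≡ f j → i ≡ j
  injective i j eq with cyclic-position i j
  ... | inj₁ j≡i = ≡-sym j≡i
  ... | inj₂ (inj₁ refl) = ⊥-elim (no-edge-collapse i eq)
  ... | inj₂ (inj₂ (inj₁ refl)) = ⊥-elim (no-edge-collapse j (≡-sym eq))
  ... | inj₂ (inj₂ (inj₂ (inj₁ refl))) = ⊥-elim (no-chord-collapse i eq)
  ... | inj₂ (inj₂ (inj₂ (inj₂ refl))) = ⊥-elim (no-chord-collapse j (≡-sym eq))

  adjacent⇒consecutive : ∀ i j → Adj G (f i) (f j) → j ≡ next5 i ⊎ i ≡ next5 j
  adjacent⇒consecutive i j e with cyclic-position i j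
  ... | inj₁ refl = ⊥-elim (irrefl G e)
  ... | inj₂ (inj₁ j≡i+1) = inj₁ j≡i+1
  ... | inj₂ (inj₂ (inj₁ i≡j+1)) = inj₂ i≡j+1
  ... | inj₂ (inj₂ (inj₂ (inj₁ refl))) = ⊥-elim (chordless i e)
  ... | inj₂ (inj₂ (inj₂ (inj₂ refl))) = ⊥-elim (chordless j (sym G e))

  consecutive⇒adjacent : ∀ i j → j ≡ next5 i ⊎ i ≡ next5 j → Adj G (f i) (f j)
  consecutive⇒adjacent i _ (inj₁ refl) = edge i
  consecutive⇒adjacent _ j (inj₂ refl) = sym G (edge j)

pentagon : Fin n → Fin n → Fin n → Fin n → Fin n → Fin 5 → Fin n
pentagon v₀ _ _ _ _ zero = v₀
pentagon _ v₁ _ _ _ (suc zero) = v₁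
pentagon _ _ v₂ _ _ (suc (suc zero)) = v₂
pentagon _ _ _ v₃ _ (suc (suc (suc zero))) = v₃
pentagon _ _ _ _ v₄ (suc (suc (suc (suc zero)))) = v₄

uniqueGeodesic⇒InducedC5 : (G : Graph n) → TriangleFree G → Diameter≤2 G →
  MinDegreeAtLeast G 2 → UniqueGeodesic G p q r →
  ∃[ b ] ∃[ a ] InducedC5 G (pentagon p q r b a)
uniqueGeodesic⇒InducedC5 {p = p} {q = q} {r = r} G triangle-free diam δ≥2 P
  with neighbour-avoiding G δ≥2 p q
... | a , p-a , a≢q with within-distance-2 G diam a r
...   | inj₁ refl = ⊥-elim (UniqueGeodesic.¬p-r P p-a)
...   | inj₂ (inj₁ a-r) = ⊥-elim (a≢q (UniqueGeodesic.unique-midpoint P p-a a-r))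
...   | inj₂ (inj₂ (b , a-b , b-r)) =
  b , a , chordless⇒InducedC5 G (pentagon p q r b a) edge chordless
  where
  open UniqueGeodesic P
  edge : ∀ i → Adj G (pentagon p q r b a i) (pentagon p q r b a (next5 i))
  edge zero = p-q
  edge (suc zero) = q-r
  edge (suc (suc zero)) = sym G b-r
  edge (suc (suc (suc zero))) = sym G a-b
  edge (suc (suc (suc (suc zero)))) = sym G p-a
  ¬q-a : ¬ Adj G q a
  ¬q-a q-a = triangle-free p q a p-q q-a p-a
  ¬p-b : ¬ Adj G p b
  ¬p-b p-b with unique-midpoint p-b b-r
  ... | refl = ¬q-a (sym G a-b)
  chordless : ∀ i → ¬ Adj G (pentagon p q r b a i) (pentagon p q r b a (next5 (next5 i)))
  chordless zero = ¬p-r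
  chordless (suc zero) = λ q-b → triangle-free q r b q-r (sym G b-r) q-b
  chordless (suc (suc zero)) = λ r-a → ⊥-elim (a≢q (unique-midpoint p-a (sym G r-a)))
  chordless (suc (suc (suc zero))) = λ b-p → ¬p-b (sym G b-p)
  chordless (suc (suc (suc (suc zero)))) = λ a-q → ¬q-a (sym G a-q)

proposition3p4 : ∀ {n} (G : Graph n) →
    TriangleFree G → EdgeCritical G → Diam2 G → MinDegreeAtLeast G 2 →
    ∀ x y → Adj G x y → EdgeInInducedC5 G x y
proposition3p4 G triangle-free critical (diam , _) δ≥2 x y x-y
  with critical⇒uniqueGeodesic G diam (critical x y x-y)
... | p , q , r , pq=xy , P
  with uniqueGeodesic⇒InducedC5 G triangle-free diam δ≥2 P
...   | b , a , C5 = pentagon p q r b a , C5 , zero , pq=xy
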